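{- Let $k\ge1$, $k'=\lfloor (k-1)/3\rfloor$, and let $c$ be any class of labeled $k$-vertex patterns. Then $2^{k'}\ge |U(c)|\ge k'+1$.
   Context: A labeled $k$-vertex pattern is a graph with a vertex ordering $(w_0,\dots,w_{k-1})$. The class $C(H)$ of a labeled pattern $H=(v_0,\dots,v_{k-1})$ consists of all labeled patterns $(w_0,\dots,w_{k-1})$ such that $v_iv_j\in E(H)$ iff $w_iw_j$ is an edge for every pair $\{i,j\}$ other than $\{0,1\},\dots,\{0,k'\}$; classes partition all labeled patterns. $U(c)$ is the set of isomorphism types of unlabeled graphs having some vertex ordering lying in $c$. -}

module Defs where

open import Data.Nat using (ℕ; zero; suc; _∸_; _≤_)
open import Data.Nat.DivMod using (_/_)
open import Data.Fin using (Fin; toℕ)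
open import Data.Fin.Permutation using (Permutation′; _⟨$⟩ʳ_)
open import Data.Bool using (Bool; false)
open import Data.Product using (Σ; ∃; _×_)
open import Data.Sum using (_⊎_)
open import Relation.Binary.PropositionalEquality using (_≡_)
open import Relation.Nullary using (¬_)

-- A labeled k-vertex pattern: a simple graph on vertex set Fin k; the
-- vertex ordering (w_0,...,w_{k-1}) is the canonical ordering of Fin k.
record Pattern (k : ℕ) : Set where
  field
    adj : Fin k → Fin k → Bool
    adj-sym : ∀ i j → adj i j ≡ adj j i
    adj-irr : ∀ i → adj i i ≡ false
open Pattern public

k′ : ℕ → ℕ
k′ k = (k ∸ 1) / 3

FreePair : (k : ℕ) → Fin k → Fin k → Set
FreePair k i j =
  (toℕ i ≡ 0 × 1 ≤ toℕ j × toℕ j ≤ k′ k) ⊎ (toℕ j ≡ 0 × 1 ≤ toℕ i × toℕ i ≤ k′ k)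

InClass : {k : ℕ} → Pattern k → Pattern k → Set
InClass {k} H G = ∀ i j → ¬ FreePair k i j → adj G i j ≡ adj H i j

Iso : {k : ℕ} → Pattern k → Pattern k → Set
Iso {k} G G′ = Σ (Permutation′ k) λ σ → ∀ i j → adj G i j ≡ adj G′ (σ ⟨$⟩ʳ i) (σ ⟨$⟩ʳ j)

-- |U(C(H))| = m : there are m pairwise non-isomorphic members of C(H)
-- such that every member of C(H) is isomorphic to one of them.
NumIsoTypes : {k : ℕ} → Pattern k → ℕ → Set
NumIsoTypes {k} H m =
  Σ (Fin m → Pattern k) λ rep →
    (∀ a → InClass H (rep a)) ×
    (∀ a b → Iso (rep a) (rep b) → a ≡ b) ×
    (∀ G → InClass H G → ∃ λ a → Iso G (rep a))

-- Members of the class C(H) differ from H only on the free pairs {0,1},…,{0,k'}, so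
-- each is determined by k' bits and there are at most 2^k' of them, hence at most
-- 2^k' isomorphism types.  Conversely, for t = 0,…,k' the member whose free edges are
-- exactly {0,1},…,{0,t} has (edges of H off the free pairs) + t edges, so these k'+1
-- members are pairwise non-isomorphic.
module Submission where

open import Defs
import Data.Nat as ℕ
open import Data.Nat using (ℕ; zero; suc; _≤_; _<_; _^_; _+_; z≤n; s≤s; _≤?_)
open import Data.Nat.Properties
  using (≤-refl; ≤-reflexive; ≤-trans; <-≤-trans; <⇒≤; ≤-pred; +-comm; +-identityʳ;
         +-mono-≤; +-mono-<-≤; +-mono-≤-<; 1+n≰n; <⇒≢; +-0-commutativeMonoid)
open import Data.Nat.DivMod using (m/n≤m)
open import Data.Bool as Bool using (Bool; true; false; b≤b; f≤t; f<t)
open import Data.Fin using (Fin; zero; suc; toℕ; fromℕ<; inject≤)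
open import Data.Fin.Properties
  using (any?; all?; toℕ-injective; toℕ-fromℕ<; toℕ-inject≤; toℕ<n; injective⇒≤)
import Data.Fin.Properties as Fin
open import Data.Fin.Permutation
  using (_⟨$⟩ʳ_; _⟨$⟩ˡ_; permutation; inverseˡ; inverseʳ; id; flip; _∘ₚ_)
open import Data.Vec using (Vec; []; _∷_; lookup; tabulate)
open import Data.Vec.Properties using (lookup∘tabulate)
import Data.List as List
open import Data.List using (List; [_]; _++_; map; length; deduplicate)
open import Data.List.Properties using (length-++; length-map; length-deduplicate)
open import Data.List.Relation.Unary.Any using (Any; index)
import Data.List.Relation.Unary.Any.Properties as Any
open import Data.List.Relation.Unary.All using (All)
import Data.List.Relation.Unary.All as All
import Data.List.Relation.Unary.All.Properties as All
open import Data.List.Relation.Unary.AllPairs using (_∷_)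
open import Data.List.Membership.Propositional using (_∈_; lose)
open import Data.List.Membership.Propositional.Properties using (∈-lookup; ∈-map⁺; ∈-++⁺ˡ; ∈-++⁺ʳ)
import Data.List.Relation.Unary.Unique.DecSetoid as Unique
open import Data.List.Relation.Unary.Unique.DecSetoid.Properties using (deduplicate-!)
open import Data.Product using (Σ; ∃; ∃₂; _×_; _,_; proj₁; proj₂)
open import Data.Sum using (inj₁; inj₂; swap)
open import Data.Empty using (⊥-elim)
open import Function using (_∘_)
open import Level using (0ℓ; _⊔_)
open import Relation.Unary using (Pred; Decidable)
open import Relation.Binary using (DecSetoid; tri<; tri≈; tri>)
open import Relation.Nullary using (¬_; Dec; yes; no; does)
open import Relation.Nullary.Decidable using (map′; _×-dec_; _⊎-dec_)
open import Relation.Binary.PropositionalEquality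
  using (_≡_; refl; sym; trans; cong; cong₂; subst; subst₂; module ≡-Reasoning)
open import Algebra.Properties.CommutativeMonoid.Sum +-0-commutativeMonoid
  using (sum; sum-permute; sum-cong-≗)

sum-mono-≤ : ∀ {n} {f g : Fin n → ℕ} → (∀ i → f i ≤ g i) → sum f ≤ sum g
sum-mono-≤ {zero}  _   = z≤n
sum-mono-≤ {suc n} f≤g = +-mono-≤ (f≤g zero) (sum-mono-≤ (f≤g ∘ suc))

sum-mono-< : ∀ {n} {f g : Fin n → ℕ} → (∀ i → f i ≤ g i) → ∀ a → f a < g a → sum f < sum g
sum-mono-< f≤g zero    fa<ga = +-mono-<-≤ fa<ga (sum-mono-≤ (f≤g ∘ suc))
sum-mono-< f≤g (suc a) fa<ga = +-mono-≤-< (f≤g zero) (sum-mono-< (f≤g ∘ suc) a fa<ga)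

does-mono-≤ : ∀ {p q} {P : Set p} {Q : Set q} (P? : Dec P) (Q? : Dec Q) →
              (P → Q) → does P? Bool.≤ does Q?
does-mono-≤ (yes _) (yes _)  _   = b≤b
does-mono-≤ (yes p) (no ¬q)  P⇒Q = ⊥-elim (¬q (P⇒Q p))
does-mono-≤ (no _)  (yes _)  _   = f≤t
does-mono-≤ (no _)  (no _)   _   = b≤b

does-mono-< : ∀ {p q} {P : Set p} {Q : Set q} (P? : Dec P) (Q? : Dec Q) →
              ¬ P → Q → does P? Bool.< does Q?
does-mono-< (yes p) _       ¬p _ = ⊥-elim (¬p p)
does-mono-< (no _)  (yes _) _  _ = f<t
does-mono-< (no _)  (no ¬q) _  q = ⊥-elim (¬q q)

any-Vec? : ∀ {n m p} {P : Pred (Vec (Fin m) n) p} → Decidable P → Dec (∃ P)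
any-Vec? {zero}  P? = map′ ([] ,_) (λ { ([] , p) → p }) (P? [])
any-Vec? {suc n} P? =
  map′ (λ (x , xs , p) → x ∷ xs , p) (λ { (x ∷ xs , p) → x , xs , p })
       (any? λ x → any-Vec? (P? ∘ (x ∷_)))

allBitVectors : ∀ n → List (Vec Bool n)
allBitVectors zero    = [ [] ]
allBitVectors (suc n) = map (true ∷_) (allBitVectors n) ++ map (false ∷_) (allBitVectors n)

length-allBitVectors : ∀ n → length (allBitVectors n) ≡ 2 ^ n
length-allBitVectors zero    = refl
length-allBitVectors (suc n) = begin
  length (map (true ∷_) vs ++ map (false ∷_) vs)          ≡⟨ length-++ (map (true ∷_) vs) ⟩
  length (map (true ∷_) vs) + length (map (false ∷_) vs)  ≡⟨ cong₂ _+_ (length-map _ vs) (length-map _ vs) ⟩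
  length vs + length vs                                    ≡⟨ cong (λ l → l + l) (length-allBitVectors n) ⟩
  2 ^ n + 2 ^ n                                            ≡⟨ cong (2 ^ n +_) (sym (+-identityʳ (2 ^ n))) ⟩
  2 ^ suc n                                                ∎
  where
  open ≡-Reasoning
  vs : List (Vec Bool n)
  vs = allBitVectors n

∈-allBitVectors : ∀ {n} (v : Vec Bool n) → v ∈ allBitVectors n
∈-allBitVectors []          = Any.here refl
∈-allBitVectors (true ∷ v)  = ∈-++⁺ˡ (∈-map⁺ (true ∷_) (∈-allBitVectors v))
∈-allBitVectors (false ∷ v) = ∈-++⁺ʳ _ (∈-map⁺ (false ∷_) (∈-allBitVectors v))

module _ {a ℓ} (S : DecSetoid a ℓ) where
  open DecSetoid S using (_≈_; _≟_)
    renaming (Carrier to A; reflexive to ≈-reflexive; sym to ≈-sym; trans to ≈-trans)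
  open Unique S using (Unique)

  -- On patterns up to isomorphism, Transversal (InClass H) m unfolds to NumIsoTypes H m.
  Transversal : ∀ {p} → Pred A p → ℕ → Set (a ⊔ ℓ ⊔ p)
  Transversal P m =
    Σ (Fin m → A) λ rep →
      (∀ a → P (rep a)) ×
      (∀ a b → rep a ≈ rep b → a ≡ b) ×
      (∀ x → P x → ∃ λ a → x ≈ rep a)

  Unique⇒lookup-injective : ∀ {xs} → Unique xs → ∀ a b → List.lookup xs a ≈ List.lookup xs b → a ≡ b
  Unique⇒lookup-injective (_ ∷ _)   zero    zero    _  = refl
  Unique⇒lookup-injective (x≉ ∷ _)  zero    (suc b) eq = ⊥-elim (All.lookup x≉ (∈-lookup b) eq)
  Unique⇒lookup-injective (x≉ ∷ _)  (suc a) zero    eq = ⊥-elim (All.lookup x≉ (∈-lookup a) (≈-sym eq))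
  Unique⇒lookup-injective (_ ∷ uxs) (suc a) (suc b) eq = cong suc (Unique⇒lookup-injective uxs a b eq)

  transversal-of-cover : ∀ {p} {P : Pred A p} xs → All P xs → (∀ x → P x → Any (x ≈_) xs) →
                         ∃ λ m → Transversal P m × m ≤ length xs
  transversal-of-cover {P = P} xs Pxs cover =
    length reps ,
    (List.lookup reps , reps-P , Unique⇒lookup-injective (deduplicate-! S xs) , reps-cover) ,
    length-deduplicate _≟_ xs
    where
    reps : List A
    reps = deduplicate _≟_ xs
    reps-P : ∀ a → P (List.lookup reps a)
    reps-P a = All.lookup (All.deduplicate⁺ _≟_ Pxs) (∈-lookup a)
    reps-cover : ∀ x → P x → ∃ λ a → x ≈ List.lookup reps a
    reps-cover x Px = index x∈reps , Any.lookup-index x∈reps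
      where
      x∈reps : Any (x ≈_) reps
      x∈reps = Any.deduplicate⁺ _≟_ (λ z≈y x≈y → ≈-trans x≈y (≈-sym z≈y)) (cover x Px)

  transversal-size-≥ : ∀ {p} {P : Pred A p} {m n} → Transversal P m →
                       (f : Fin n → A) → (∀ i → P (f i)) → (∀ i j → f i ≈ f j → i ≡ j) → n ≤ m
  transversal-size-≥ {m = m} {n} (rep , _ , _ , cover) f Pf f-injective = injective⇒≤ {f = repOf} repOf-injective
    where
    repOf : Fin n → Fin m
    repOf i = proj₁ (cover (f i) (Pf i))
    repOf-injective : ∀ {i j} → repOf i ≡ repOf j → i ≡ j
    repOf-injective {i} {j} eq = f-injective i j
      (≈-trans (proj₂ (cover (f i) (Pf i)))
        (≈-trans (≈-reflexive (cong rep eq)) (≈-sym (proj₂ (cover (f j) (Pf j))))))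

module _ {k : ℕ} where

  Iso-pointwise : ∀ (G G′ : Pattern k) → (∀ i j → adj G i j ≡ adj G′ i j) → Iso G G′
  Iso-pointwise _ _ G≗G′ = id , G≗G′

  Iso-sym : ∀ (G G′ : Pattern k) → Iso G G′ → Iso G′ G
  Iso-sym G G′ (σ , G≅G′) = flip σ , λ i j →
    sym (trans (G≅G′ (σ ⟨$⟩ˡ i) (σ ⟨$⟩ˡ j)) (cong₂ (adj G′) (inverseʳ σ) (inverseʳ σ)))

  Iso-trans : ∀ (G G′ G″ : Pattern k) → Iso G G′ → Iso G′ G″ → Iso G G″
  Iso-trans G G′ G″ (σ , G≅G′) (τ , G′≅G″) =
    σ ∘ₚ τ , λ i j → trans (G≅G′ i j) (G′≅G″ (σ ⟨$⟩ʳ i) (σ ⟨$⟩ʳ j))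

  -- An isomorphism given by the value tables v of σ and w of σ⁻¹: unlike
  -- Permutation′ k, pairs of tables can be searched exhaustively.
  IsoVia : Pattern k → Pattern k → Vec (Fin k) k → Vec (Fin k) k → Set
  IsoVia G G′ v w =
    (∀ i → lookup v (lookup w i) ≡ i) ×
    (∀ i → lookup w (lookup v i) ≡ i) ×
    (∀ i j → adj G i j ≡ adj G′ (lookup v i) (lookup v j))

  isoVia? : ∀ G G′ v w → Dec (IsoVia G G′ v w)
  isoVia? G G′ v w =
    all? (λ i → lookup v (lookup w i) Fin.≟ i) ×-dec
    all? (λ i → lookup w (lookup v i) Fin.≟ i) ×-dec
    all? (λ i → all? λ j → adj G i j Bool.≟ adj G′ (lookup v i) (lookup v j))

  Iso? : ∀ G G′ → Dec (Iso G G′)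
  Iso? G G′ = map′ fromVectors toVectors (any-Vec? λ v → any-Vec? (isoVia? G G′ v))
    where
    fromVectors : (∃₂ λ v w → IsoVia G G′ v w) → Iso G G′
    fromVectors (v , w , vw≗id , wv≗id , G≅G′) =
      permutation (lookup v) (lookup w) vw≗id wv≗id , G≅G′
    toVectors : Iso G G′ → ∃₂ λ v w → IsoVia G G′ v w
    toVectors (σ , G≅G′) = v , w , vw≗id , wv≗id , λ i j →
        trans (G≅G′ i j) (sym (cong₂ (adj G′) (lookup∘tabulate (σ ⟨$⟩ʳ_) i) (lookup∘tabulate (σ ⟨$⟩ʳ_) j)))
      where
      v w : Vec (Fin k) k
      v = tabulate (σ ⟨$⟩ʳ_)
      w = tabulate (σ ⟨$⟩ˡ_)
      vw≗id : ∀ i → lookup v (lookup w i) ≡ i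
      vw≗id i = trans (lookup∘tabulate (σ ⟨$⟩ʳ_) (lookup w i))
                      (trans (cong (σ ⟨$⟩ʳ_) (lookup∘tabulate (σ ⟨$⟩ˡ_) i)) (inverseʳ σ))
      wv≗id : ∀ i → lookup w (lookup v i) ≡ i
      wv≗id i = trans (lookup∘tabulate (σ ⟨$⟩ˡ_) (lookup v i))
                      (trans (cong (σ ⟨$⟩ˡ_) (lookup∘tabulate (σ ⟨$⟩ʳ_) i)) (inverseˡ σ))

isoDecSetoid : ℕ → DecSetoid 0ℓ 0ℓ
isoDecSetoid k = record
  { Carrier          = Pattern k
  ; _≈_              = Iso
  ; isDecEquivalence = record
    { isEquivalence = record
      { refl  = λ {G} → Iso-pointwise G G (λ _ _ → refl)
      ; sym   = λ {G} {G′} → Iso-sym G G′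
      ; trans = λ {G} {G′} {G″} → Iso-trans G G′ G″
      }
    ; _≟_           = Iso?
    }
  }

boolToℕ : Bool → ℕ
boolToℕ false = 0
boolToℕ true  = 1

boolToℕ-mono-≤ : ∀ {b c} → b Bool.≤ c → boolToℕ b ≤ boolToℕ c
boolToℕ-mono-≤ f≤t = z≤n
boolToℕ-mono-≤ b≤b = ≤-refl

boolToℕ-mono-< : ∀ {b c} → b Bool.< c → boolToℕ b < boolToℕ c
boolToℕ-mono-< f<t = s≤s z≤n

edgeCount : ∀ {k} → Pattern k → ℕ
edgeCount G = sum λ i → sum λ j → boolToℕ (adj G i j)

edgeCount-invariant : ∀ {k} (G G′ : Pattern k) → Iso G G′ → edgeCount G ≡ edgeCount G′
edgeCount-invariant {k} G G′ (σ , G≅G′) = begin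
  sum (λ i → sum λ j → count G i j)                          ≡⟨ sum-cong-≗ (λ i → sum-cong-≗ λ j → cong boolToℕ (G≅G′ i j)) ⟩
  sum (λ i → sum λ j → count G′ (σ ⟨$⟩ʳ i) (σ ⟨$⟩ʳ j))      ≡⟨ sum-cong-≗ (λ i → sym (sum-permute (count G′ (σ ⟨$⟩ʳ i)) σ)) ⟩
  sum (λ i → sum λ j → count G′ (σ ⟨$⟩ʳ i) j)                ≡⟨ sym (sum-permute (λ i → sum (count G′ i)) σ) ⟩
  sum (λ i → sum λ j → count G′ i j)                         ∎
  where
  open ≡-Reasoning
  count : Pattern k → Fin k → Fin k → ℕ
  count G i j = boolToℕ (adj G i j)

edgeCount-mono-< : ∀ {k} (G G′ : Pattern k) → (∀ i j → adj G i j Bool.≤ adj G′ i j) →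
                   ∀ i j → adj G i j Bool.< adj G′ i j → edgeCount G < edgeCount G′
edgeCount-mono-< G G′ G⊆G′ i j G<G′ =
  sum-mono-< (λ i′ → sum-mono-≤ (row≤ i′)) i (sum-mono-< (row≤ i) j (boolToℕ-mono-< G<G′))
  where
  row≤ : ∀ i′ j′ → boolToℕ (adj G i′ j′) ≤ boolToℕ (adj G′ i′ j′)
  row≤ i′ j′ = boolToℕ-mono-≤ (G⊆G′ i′ j′)

FreePair? : ∀ {k} (i j : Fin k) → Dec (FreePair k i j)
FreePair? {k} i j =
  (toℕ i ℕ.≟ 0 ×-dec 1 ≤? toℕ j ×-dec toℕ j ≤? k′ k) ⊎-dec
  (toℕ j ℕ.≟ 0 ×-dec 1 ≤? toℕ i ×-dec toℕ i ≤? k′ k)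

FreePair-irrefl : ∀ {k} (i : Fin k) → ¬ FreePair k i i
FreePair-irrefl i (inj₁ (i≡0 , 1≤i , _)) = 1+n≰n (subst (1 ≤_) i≡0 1≤i)
FreePair-irrefl i (inj₂ (i≡0 , 1≤i , _)) = 1+n≰n (subst (1 ≤_) i≡0 1≤i)

module Splice {k} (H : Pattern k) where

  -- b x decides the free pair {0, x}: one endpoint of a free pair is 0, so
  -- toℕ i + toℕ j is the other one, and the definition is symmetric.
  spliceAdj : (ℕ → Bool) → Fin k → Fin k → Bool
  spliceAdj b i j with FreePair? i j
  ... | yes _ = b (toℕ i + toℕ j)
  ... | no  _ = adj H i j

  spliceAdj-sym : ∀ b i j → spliceAdj b i j ≡ spliceAdj b j i
  spliceAdj-sym b i j with FreePair? i j | FreePair? j i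
  ... | yes _    | yes _    = cong b (+-comm (toℕ i) (toℕ j))
  ... | yes free | no fixed = ⊥-elim (fixed (swap free))
  ... | no fixed | yes free = ⊥-elim (fixed (swap free))
  ... | no _     | no _     = adj-sym H i j

  spliceAdj-irr : ∀ b i → spliceAdj b i i ≡ false
  spliceAdj-irr b i with FreePair? i i
  ... | yes free = ⊥-elim (FreePair-irrefl i free)
  ... | no _     = adj-irr H i

  splice : (ℕ → Bool) → Pattern k
  splice b = record { adj = spliceAdj b ; adj-sym = spliceAdj-sym b ; adj-irr = spliceAdj-irr b }

  splice-inClass : ∀ b → InClass H (splice b)
  splice-inClass b i j fixed with FreePair? i j
  ... | yes free = ⊥-elim (fixed free)
  ... | no _     = refl

  splice-free : ∀ b {i j} → FreePair k i j → adj (splice b) i j ≡ b (toℕ i + toℕ j)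
  splice-free b {i} {j} free with FreePair? i j
  ... | yes _    = refl
  ... | no fixed = ⊥-elim (fixed free)

  splice-mono-≤ : ∀ {b c} → (∀ x → b x Bool.≤ c x) →
                  ∀ i j → adj (splice b) i j Bool.≤ adj (splice c) i j
  splice-mono-≤ b≤c i j with FreePair? i j
  ... | yes _ = b≤c (toℕ i + toℕ j)
  ... | no _  = b≤b

  Iso-splice : ∀ G b → InClass H G → (∀ i j → FreePair k i j → adj G i j ≡ b (toℕ i + toℕ j)) →
               Iso G (splice b)
  Iso-splice G b G∈C G≡b = Iso-pointwise G (splice b) agree
    where
    agree : ∀ i j → adj G i j ≡ spliceAdj b i j
    agree i j with FreePair? i j
    ... | yes free = G≡b i j free
    ... | no fixed = G∈C i j fixed

-- Bit x of p is read at position suc x, the free pair {0, suc x}; position 0 is junk.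
spokeBits : ∀ {K} → Vec Bool K → ℕ → Bool
spokeBits _       zero          = false
spokeBits []      (suc _)       = false
spokeBits (c ∷ _) (suc zero)    = c
spokeBits (_ ∷ p) (suc (suc x)) = spokeBits p (suc x)

spokeBits-tabulate : ∀ {K} (g : Fin K → Bool) x → spokeBits (tabulate g) (suc (toℕ x)) ≡ g x
spokeBits-tabulate g zero    = refl
spokeBits-tabulate g (suc x) = spokeBits-tabulate (g ∘ suc) x

threshold : ℕ → ℕ → Bool
threshold t x = does (x ≤? t)

module Members {n} (H : Pattern (suc n)) where
  open Splice H

  K : ℕ
  K = k′ (suc n)

  K≤n : K ≤ n
  K≤n = m/n≤m n 3

  spokes : Pattern (suc n) → Vec Bool K
  spokes G = tabulate λ x → adj G zero (suc (inject≤ x K≤n))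

  spokeBits-spokes : ∀ G (j : Fin n) → toℕ j < K →
                     spokeBits (spokes G) (suc (toℕ j)) ≡ adj G zero (suc j)
  spokeBits-spokes G j j<K = begin
    spokeBits (spokes G) (suc (toℕ j))  ≡⟨ cong (spokeBits (spokes G) ∘ suc) (sym (toℕ-fromℕ< j<K)) ⟩
    spokeBits (spokes G) (suc (toℕ x))  ≡⟨ spokeBits-tabulate _ x ⟩
    adj G zero (suc (inject≤ x K≤n))    ≡⟨ cong (adj G zero ∘ suc) (toℕ-injective (trans (toℕ-inject≤ x K≤n) (toℕ-fromℕ< j<K))) ⟩
    adj G zero (suc j)                  ∎
    where
    open ≡-Reasoning
    x : Fin K
    x = fromℕ< j<K

  spokeBits-free : ∀ G i j → FreePair (suc n) i j → adj G i j ≡ spokeBits (spokes G) (toℕ i + toℕ j)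
  spokeBits-free G zero    zero    (inj₁ (_ , () , _))
  spokeBits-free G zero    zero    (inj₂ (_ , () , _))
  spokeBits-free G zero    (suc j) (inj₁ (_ , _ , j<K)) = sym (spokeBits-spokes G j j<K)
  spokeBits-free G zero    (suc j) (inj₂ (() , _))
  spokeBits-free G (suc i) zero    (inj₁ (() , _))
  spokeBits-free G (suc i) zero    (inj₂ (_ , _ , i<K)) =
    trans (adj-sym G (suc i) zero)
      (trans (sym (spokeBits-spokes G i i<K)) (cong (spokeBits (spokes G)) (sym (+-identityʳ (suc (toℕ i))))))
  spokeBits-free G (suc i) (suc j) (inj₁ (() , _))
  spokeBits-free G (suc i) (suc j) (inj₂ (() , _))

  classMembers : List (Pattern (suc n))
  classMembers = map (splice ∘ spokeBits) (allBitVectors K)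

  length-classMembers : length classMembers ≡ 2 ^ K
  length-classMembers = trans (length-map _ (allBitVectors K)) (length-allBitVectors K)

  classMembers-inClass : All (InClass H) classMembers
  classMembers-inClass = All.map⁺ (All.universal (splice-inClass ∘ spokeBits) (allBitVectors K))

  classMembers-cover : ∀ G → InClass H G → Any (Iso G) classMembers
  classMembers-cover G G∈C =
    lose {P = Iso G} (∈-map⁺ (splice ∘ spokeBits) (∈-allBitVectors (spokes G)))
         (Iso-splice G (spokeBits (spokes G)) G∈C (spokeBits-free G))

  thresholdMember : Fin (suc K) → Pattern (suc n)
  thresholdMember t = splice (threshold (toℕ t))

  edgeCount-threshold-< : ∀ {s t} → s < t → t ≤ K →
                          edgeCount (splice (threshold s)) < edgeCount (splice (threshold t))
  edgeCount-threshold-< {s} {t} s<t t≤K =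
    edgeCount-mono-< (splice (threshold s)) (splice (threshold t))
      (splice-mono-≤ λ x → does-mono-≤ (x ≤? s) (x ≤? t) (λ x≤s → ≤-trans x≤s (<⇒≤ s<t)))
      zero v
      (subst₂ Bool._<_ (sym (splice-free _ free)) (sym (splice-free _ free))
        (does-mono-< (toℕ v ≤? s) (toℕ v ≤? t) v≰s v≤t))
    where
    s<n : s < n
    s<n = <-≤-trans s<t (≤-trans t≤K K≤n)
    v : Fin (suc n)
    v = suc (fromℕ< s<n)
    toℕv≡1+s : toℕ v ≡ suc s
    toℕv≡1+s = cong suc (toℕ-fromℕ< s<n)
    v≰s : ¬ toℕ v ≤ s
    v≰s v≤s = 1+n≰n (subst (_≤ s) toℕv≡1+s v≤s)
    v≤t : toℕ v ≤ t
    v≤t = subst (_≤ t) (sym toℕv≡1+s) s<t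
    free : FreePair (suc n) zero v
    free = inj₁ (refl , s≤s z≤n , ≤-trans v≤t t≤K)

  thresholdMember-injective : ∀ s t → Iso (thresholdMember s) (thresholdMember t) → s ≡ t
  thresholdMember-injective s t s≅t
    with Fin.<-cmp s t | edgeCount-invariant (thresholdMember s) (thresholdMember t) s≅t
  ... | tri< s<t _ _ | count≡ = ⊥-elim (<⇒≢ (edgeCount-threshold-< s<t (≤-pred (toℕ<n t))) count≡)
  ... | tri≈ _ s≡t _ | _      = s≡t
  ... | tri> _ _ t<s | count≡ = ⊥-elim (<⇒≢ (edgeCount-threshold-< t<s (≤-pred (toℕ<n s))) (sym count≡))

  isoTypes : ∃ λ m → NumIsoTypes H m × m ≤ 2 ^ K
  isoTypes with m , types , m≤ ← transversal-of-cover (isoDecSetoid (suc n)) classMembers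
                                   classMembers-inClass classMembers-cover
    = m , types , ≤-trans m≤ (≤-reflexive length-classMembers)

  isoTypes-size-≥ : ∀ {m} → NumIsoTypes H m → K + 1 ≤ m
  isoTypes-size-≥ {m} types = subst (_≤ m) (+-comm 1 K)
    (transversal-size-≥ (isoDecSetoid (suc n)) types thresholdMember
      (splice-inClass ∘ threshold ∘ toℕ) thresholdMember-injective)

corollary3p5 : (k : ℕ) → 1 ≤ k → (H : Pattern k) →
    ∃ λ m → NumIsoTypes H m × m ≤ 2 ^ k′ k × k′ k + 1 ≤ m
corollary3p5 (suc n) _ H with m , types , m≤2^k′ ← Members.isoTypes H =
  m , types , m≤2^k′ , Members.isoTypes-size-≥ H types
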